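{- Let $(\mathbf{C},\mathcal M)$ be an $\mathcal M$-adhesive category and $\rho_1,\rho_2$ rules with application conditions. Let $tp$ be a pair of direct transformations $H_1\Leftarrow_{\rho_1,m_1}G\Rightarrow_{\rho_2,m_2}H_2$ which is a use-delete (resp. delete-use) conflict, and let $tp'$ be another pair of direct transformations via $\rho_1,\rho_2$ that can be embedded into $tp$ via an extension morphism $f$ and corresponding extension diagrams. Then $tp'$ is also a use-delete (resp. delete-use) conflict.
   Context: An $\mathcal M$-adhesive category is a category with a distinguished class $\mathcal M$ of monomorphisms satisfying the standard axioms (including the van Kampen property). Application conditions (ACs) over an object $P$: for every morphism $a\colon P\to C$ and AC $ac_C$ over $C$, $\exists(a,ac_C)$ is an AC over $P$; negations and finite conjunctions of ACs over $P$ are ACs over $P$ (the empty conjunction is $\mathrm{true}$). A morphism $p\colon P\to G$ satisfies $\exists(a,ac_C)$ if there is $q\colon C\to G$ in $\mathcal M$ with $q\circ a=p$ and $q\models ac_C$; $\neg$ and $\wedge$ are interpreted as usual. A rule $\rho=\langle p,ac_L\rangle$ consists of a plain rule $p=(L\leftarrow I\rightarrow R)$ with both morphisms in $\mathcal M$ and an AC $ac_L$ over $L$. A direct transformation $G\Rightarrow_{\rho,m}H$ is a double pushout diagram for $p$ with match $m\colon L\to G$ (intermediate object $D$, $k\colon D\to G$, $c\colon D\to H$) such that $m\models ac_L$. For a pair $H_1\Leftarrow_{\rho_1,m_1}G\Rightarrow_{\rho_2,m_2}H_2$ with $k_i\colon D_i\to G$: it is a use-delete conflict if there is no $d_{12}\colon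 L_1\to D_2$ with $k_2\circ d_{12}=m_1$, and a delete-use conflict if there is no $d_{21}\colon L_2\to D_1$ with $k_1\circ d_{21}=m_2$. A pair $tp'\colon P_1\Leftarrow_{\rho_1,o_1}K\Rightarrow_{\rho_2,o_2}P_2$ can be embedded into $tp\colon H_1\Leftarrow_{\rho_1,m_1}G\Rightarrow_{\rho_2,m_2}H_2$ via extension morphism $f\colon K\to G$ if $m_j=f\circ o_j$ and for each $j$ there are morphisms between the intermediate and result objects making all squares between the two double pushout diagrams commute and be pushouts (extension diagrams). -}

module Defs where

open import Level using (Level; _⊔_; suc)
open import Data.Product using (Σ; Σ-syntax; _×_; _,_)
open import Data.List using (List; []; _∷_)
open import Data.Unit.Polymorphic using (⊤)
open import Relation.Nullary using (¬_)
open import Relation.Binary.PropositionalEquality using (_≡_)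

record Category (o ℓ : Level) : Set (suc (o ⊔ ℓ)) where
  infixr 9 _∘_
  field
    Obj  : Set o
    Hom  : Obj → Obj → Set ℓ
    id   : ∀ {A} → Hom A A
    _∘_  : ∀ {A B C} → Hom B C → Hom A B → Hom A C
    identityˡ : ∀ {A B} {f : Hom A B} → id ∘ f ≡ f
    identityʳ : ∀ {A B} {f : Hom A B} → f ∘ id ≡ f
    assoc     : ∀ {A B C D} {f : Hom A B} {g : Hom B C} {h : Hom C D} →
                (h ∘ g) ∘ f ≡ h ∘ (g ∘ f)

module CatDefs {o ℓ : Level} (𝒞 : Category o ℓ) where
  open Category 𝒞

  Mono : ∀ {A B} → Hom A B → Set (o ⊔ ℓ)
  Mono {A} f = ∀ {X} (g h : Hom X A) → f ∘ g ≡ f ∘ h → g ≡ h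

  IsIso : ∀ {A B} → Hom A B → Set ℓ
  IsIso {A} {B} f = Σ[ g ∈ Hom B A ] ((g ∘ f ≡ id) × (f ∘ g ≡ id))

  ∃!Hom : ∀ {X Y} → (Hom X Y → Set ℓ) → Set ℓ
  ∃!Hom {X} {Y} P = Σ[ u ∈ Hom X Y ] (P u × (∀ (u' : Hom X Y) → P u' → u' ≡ u))

  -- The square
  --     A --f--> B
  --     |        |
  --     g        f'
  --     v        v
  --     C --g'-> D
  CommSq : ∀ {A B C D} → Hom A B → Hom A C → Hom B D → Hom C D → Set ℓ
  CommSq f g f' g' = f' ∘ f ≡ g' ∘ g

  IsPushout : ∀ {A B C D} → Hom A B → Hom A C → Hom B D → Hom C D → Set (o ⊔ ℓ)
  IsPushout {A} {B} {C} {D} f g f' g' =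
    CommSq f g f' g' ×
    (∀ {X} (x : Hom B X) (y : Hom C X) → x ∘ f ≡ y ∘ g →
       ∃!Hom {D} {X} (λ u → (u ∘ f' ≡ x) × (u ∘ g' ≡ y)))

  IsPullback : ∀ {A B C D} → Hom A B → Hom A C → Hom B D → Hom C D → Set (o ⊔ ℓ)
  IsPullback {A} {B} {C} {D} f g f' g' =
    CommSq f g f' g' ×
    (∀ {X} (x : Hom X B) (y : Hom X C) → f' ∘ x ≡ g' ∘ y →
       ∃!Hom {X} {A} (λ u → (f ∘ u ≡ x) × (g ∘ u ≡ y)))

record MAdhesive {o ℓ : Level} (𝒞 : Category o ℓ) (ℓm : Level) : Set (suc (o ⊔ ℓ ⊔ ℓm)) where
  open Category 𝒞
  open CatDefs 𝒞
  field
    M        : ∀ {A B} → Hom A B → Set ℓm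
    M-mono   : ∀ {A B} {f : Hom A B} → M f → Mono f
    M-iso    : ∀ {A B} {f : Hom A B} → IsIso f → M f
    M-comp   : ∀ {A B C} {f : Hom A B} {g : Hom B C} → M f → M g → M (g ∘ f)
    M-decomp : ∀ {A B C} {f : Hom A B} {g : Hom B C} → M (g ∘ f) → M g → M f
    pushout-along-M : ∀ {A B C} (m : Hom A B) → M m → (f : Hom A C) →
      Σ[ D ∈ Obj ] Σ[ g ∈ Hom B D ] Σ[ n ∈ Hom C D ] IsPushout m f g n
    M-pushout-stable : ∀ {A B C D} {m : Hom A B} {f : Hom A C} {g : Hom B D} {n : Hom C D} →
      IsPushout m f g n → M m → M n
    pullback-along-M : ∀ {B C D} (g : Hom B D) (n : Hom C D) → M n →
      Σ[ A ∈ Obj ] Σ[ m ∈ Hom A B ] Σ[ f ∈ Hom A C ] IsPullback m f g n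
    M-pullback-stable : ∀ {A B C D} {m : Hom A B} {f : Hom A C} {g : Hom B D} {n : Hom C D} →
      IsPullback m f g n → M n → M m
    -- pushouts along M-morphisms are M-van Kampen squares:
    -- bottom face (m, f, g, n), top face (m', f', g', n'), vertical a b c d with b c d ∈ M
    van-Kampen :
      ∀ {A B C D A' B' C' D'}
        {m : Hom A B} {f : Hom A C} {g : Hom B D} {n : Hom C D}
        {m' : Hom A' B'} {f' : Hom A' C'} {g' : Hom B' D'} {n' : Hom C' D'}
        {a : Hom A' A} {b : Hom B' B} {c : Hom C' C} {d : Hom D' D} →
      IsPushout m f g n → M m → M b → M c → M d →
      CommSq m' f' g' n' →
      CommSq g' b d g → CommSq n' c d n →
      IsPullback m' a b m → IsPullback f' a c f →
      (IsPushout m' f' g' n' → IsPullback g' b d g × IsPullback n' c d n) ×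
      (IsPullback g' b d g × IsPullback n' c d n → IsPushout m' f' g' n')

module Rules {o ℓ ℓm : Level} (𝒞 : Category o ℓ) (𝓜 : MAdhesive 𝒞 ℓm) where
  open Category 𝒞
  open CatDefs 𝒞
  open MAdhesive 𝓜

  data AC : Obj → Set (o ⊔ ℓ) where
    ∃AC : ∀ {P C} → Hom P C → AC C → AC P
    ¬AC : ∀ {P} → AC P → AC P
    ⋀AC : ∀ {P} → List (AC P) → AC P

  trueAC : ∀ {P} → AC P
  trueAC = ⋀AC []

  infix 4 _⊨_ _⊨all_
  mutual
    _⊨_ : ∀ {P G} → Hom P G → AC P → Set (ℓ ⊔ ℓm)
    _⊨_ {G = G} p (∃AC {C = C} a ac) =
      Σ[ q ∈ Hom C G ] (M q × (q ∘ a ≡ p) × (q ⊨ ac))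
    p ⊨ ¬AC ac  = ¬ (p ⊨ ac)
    p ⊨ ⋀AC acs = p ⊨all acs

    _⊨all_ : ∀ {P G} → Hom P G → List (AC P) → Set (ℓ ⊔ ℓm)
    p ⊨all []         = ⊤
    p ⊨all (ac ∷ acs) = (p ⊨ ac) × (p ⊨all acs)

  record Rule : Set (o ⊔ ℓ ⊔ ℓm) where
    field
      L I R : Obj
      l     : Hom I L
      r     : Hom I R
      l∈M   : M l
      r∈M   : M r
      ac    : AC L

  -- direct transformation G ⇒_{ρ,m} H:
  --   L <-l- I -r-> R
  --   |m     |u     |n
  --   G <-k- D -c-> H     (both squares pushouts), m ⊨ ac
  record DirectTransformation (ρ : Rule) (G : Obj) : Set (o ⊔ ℓ ⊔ ℓm) where
    open Rule ρ
    field
      m   : Hom L G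
      D H : Obj
      k   : Hom D G
      c   : Hom D H
      u   : Hom I D
      n   : Hom R H
      po₁ : IsPushout l u m k
      po₂ : IsPushout r u n c
      sat : m ⊨ ac

  open DirectTransformation

  UseDeleteConflict : ∀ {ρ₁ ρ₂ G} → DirectTransformation ρ₁ G → DirectTransformation ρ₂ G → Set ℓ
  UseDeleteConflict {ρ₁} t₁ t₂ =
    ¬ (Σ[ d₁₂ ∈ Hom (Rule.L ρ₁) (D t₂) ] (k t₂ ∘ d₁₂ ≡ m t₁))

  DeleteUseConflict : ∀ {ρ₁ ρ₂ G} → DirectTransformation ρ₁ G → DirectTransformation ρ₂ G → Set ℓ
  DeleteUseConflict {ρ₂ = ρ₂} t₁ t₂ =
    ¬ (Σ[ d₂₁ ∈ Hom (Rule.L ρ₂) (D t₁) ] (k t₁ ∘ d₂₁ ≡ m t₂))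

  record ExtensionDiagram {ρ : Rule} {K G : Obj} (f : Hom K G)
           (t' : DirectTransformation ρ K) (t : DirectTransformation ρ G) : Set (o ⊔ ℓ) where
    field
      d     : Hom (D t') (D t)
      h     : Hom (H t') (H t)
      m≡    : m t ≡ f ∘ m t'
      u≡    : u t ≡ d ∘ u t'
      n≡    : n t ≡ h ∘ n t'
      po-k  : IsPushout (k t') d f (k t)
      po-c  : IsPushout (c t') d h (c t)

  record Embedding {ρ₁ ρ₂ : Rule} {K G : Obj}
           (t₁' : DirectTransformation ρ₁ K) (t₂' : DirectTransformation ρ₂ K)
           (t₁ : DirectTransformation ρ₁ G) (t₂ : DirectTransformation ρ₂ G) : Set (o ⊔ ℓ) where
    field
      f    : Hom K G
      ext₁ : ExtensionDiagram f t₁' t₁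
      ext₂ : ExtensionDiagram f t₂' t₂

{-# OPTIONS --safe #-}
module Submission where

open import Defs
open import Level using (Level)
open import Data.Product using (Σ-syntax; _×_; _,_; proj₁)
open import Function using (_∘′_)
open import Relation.Binary.PropositionalEquality using (_≡_; sym; trans; cong; module ≡-Reasoning)

-- Postcomposing with the extension morphism d : D' → D
-- carries a factorisation in the embedded pair to one in the big pair, since
-- k ∘ d = f ∘ k'; only this commutativity of the extension square is needed,
-- not its pushout property.

module _ {o ℓ ℓm : Level} (𝒞 : Category o ℓ) (𝓜 : MAdhesive 𝒞 ℓm) where
  open Category 𝒞
  open Rules 𝒞 𝓜
  open DirectTransformation
  open ExtensionDiagram

  factorisation-extends :
    ∀ {ρ K G X} {f : Hom K G} {t' : DirectTransformation ρ K} {t : DirectTransformation ρ G}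
      (E : ExtensionDiagram f t' t) {g : Hom X K} →
    Σ[ x ∈ Hom X (D t') ] (k t' ∘ x ≡ g) →
    Σ[ y ∈ Hom X (D t) ] (k t ∘ y ≡ f ∘ g)
  factorisation-extends {f = f} {t'} {t} E {g} (x , kx≡g) = d E ∘ x , (begin
    k t ∘ (d E ∘ x)   ≡⟨ sym assoc ⟩
    (k t ∘ d E) ∘ x   ≡⟨ cong (_∘ x) (sym (proj₁ (po-k E))) ⟩
    (f ∘ k t') ∘ x    ≡⟨ assoc ⟩
    f ∘ (k t' ∘ x)    ≡⟨ cong (f ∘_) kx≡g ⟩
    f ∘ g             ∎)
    where open ≡-Reasoning

  match-factorisation-extends :
    ∀ {ρ ρ' K G} {f : Hom K G}
      {t' : DirectTransformation ρ K} {t : DirectTransformation ρ G}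
      {s' : DirectTransformation ρ' K} {s : DirectTransformation ρ' G} →
    ExtensionDiagram f t' t → ExtensionDiagram f s' s →
    Σ[ x ∈ Hom (Rule.L ρ') (D t') ] (k t' ∘ x ≡ m s') →
    Σ[ y ∈ Hom (Rule.L ρ') (D t) ] (k t ∘ y ≡ m s)
  match-factorisation-extends Et Es fact =
    let y , ky≡fm' = factorisation-extends Et fact in y , trans ky≡fm' (sym (m≡ Es))

lemma4 : ∀ {o ℓ ℓm : Level} (𝒞 : Category o ℓ) (𝓜 : MAdhesive 𝒞 ℓm) →
    let open Rules 𝒞 𝓜 in
    ∀ (ρ₁ ρ₂ : Rule) {G K : Category.Obj 𝒞}
      (t₁ : DirectTransformation ρ₁ G) (t₂ : DirectTransformation ρ₂ G)
      (t₁' : DirectTransformation ρ₁ K) (t₂' : DirectTransformation ρ₂ K) →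
      Embedding t₁' t₂' t₁ t₂ →
      (UseDeleteConflict t₁ t₂ → UseDeleteConflict t₁' t₂') ×
      (DeleteUseConflict t₁ t₂ → DeleteUseConflict t₁' t₂')
lemma4 𝒞 𝓜 ρ₁ ρ₂ t₁ t₂ t₁' t₂' emb =
    (λ useDelete → useDelete ∘′ match-factorisation-extends 𝒞 𝓜 ext₂ ext₁)
  , (λ deleteUse → deleteUse ∘′ match-factorisation-extends 𝒞 𝓜 ext₁ ext₂)
  where open Rules.Embedding emb
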